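{- For each non-negative integer $n$, \[ \sum_{k=0}^n (-1)^{k} \binom {n+k}{k} \frac{F_{2(n+1)-k}}{2^k} = 2^n - \sum_{k=0}^{n-1} (-1)^{k}\binom {2k+1}{k} 2^{n-2k-1} F_{k+2}, \] \[ \sum_{k=0}^n (-1)^{k}\binom {n+k}{k} \frac{L_{2(n+1)-k}}{2^k} = 3\cdot 2^n - \sum_{k=0}^{n-1} (-1)^{k}\binom {2k+1}{k} 2^{n-2k-1} L_{k+2}. \]
   Context: $F_j$ and $L_j$ denote the Fibonacci and Lucas numbers: $F_0=0,F_1=1$, $L_0=2,L_1=1$, both satisfying $X_j=X_{j-1}+X_{j-2}$. -}

module Defs where

open import Data.Nat as ℕ using (ℕ; zero; suc)
open import Data.Nat.Combinatorics using (_C_)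
open import Data.Integer as ℤ using (ℤ; +_; -[1+_])
open import Data.Rational using (ℚ; _/_; _+_; _*_; -_; 0ℚ)

F : ℕ → ℕ
F 0 = 0
F 1 = 1
F (suc (suc j)) = F (suc j) ℕ.+ F j

L : ℕ → ℕ
L 0 = 2
L 1 = 1
L (suc (suc j)) = L (suc j) ℕ.+ L j

ℕ→ℚ : ℕ → ℚ
ℕ→ℚ m = + m / 1

2^ : ℤ → ℚ
2^ (+ m) = + (2 ℕ.^ m) / 1
2^ -[1+ m ] = half m
  where
  -- half m = 1 / 2^(m+1)
  half : ℕ → ℚ
  half zero = + 1 / 2
  half (suc m) = half m * (+ 1 / 2)

sgn : ℕ → ℚ
sgn zero = + 1 / 1
sgn (suc k) = - sgn k

sumBelow : ℕ → (ℕ → ℚ) → ℚ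
sumBelow zero f = 0ℚ
sumBelow (suc n) f = sumBelow n f + f n

-- Write S n for the left-hand side, with an arbitrary sequence X satisfying X (j+2) = X (j+1) + X j
-- in place of F or L. Using X (m+3) = 2 X (m+1) + X m, Pascal's rule for C(n+k,k), and the
-- fact that doubling the weight (-1/2)^(k+1) gives -(-1/2)^k, the interior terms of 2 S n cancel
-- against S (n+1) and one finds S (n+1) = 2 S n - (-1/2)^n C(2n+1,n) X (n+2). The right-hand side
-- obeys the same recurrence because each of its summands doubles with n while a new summand
-- appears, and both sides equal X 2 at n = 0.
module Submission where

open import Defs
open import Data.Nat as ℕ using (ℕ; zero; suc; _≤_)
import Data.Nat.Properties as ℕP
open import Data.Nat.Combinatorics using (_C_; nCk+nC[k+1]≡[n+1]C[k+1]; nCk≡nC[n∸k])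
import Data.Nat.Tactic.RingSolver as ℕSolver
open import Data.Integer as ℤ using (+_; -[1+_])
import Data.Integer.Properties as ℤP
import Data.Integer.Tactic.RingSolver as ℤSolver
open import Data.Rational using (ℚ; _+_; _*_; -_; _-_; 0ℚ; 1ℚ; ½; toℚᵘ)
import Data.Rational.Properties as ℚP
import Data.Rational.Unnormalised as ℚᵘ
import Data.Rational.Unnormalised.Properties as ℚᵘP
import Data.Nat.Coprimality as Coprimality
open import Data.Product using (_×_; _,_)
open import Relation.Nullary.Decidable using (dec⇒maybe)
open import Level using (0ℓ)
open import Relation.Binary.PropositionalEquality
import Tactic.RingSolver.Core.AlmostCommutativeRing as ACR
open import Tactic.RingSolver using (solve-∀)

-- The zero test lets the solver cancel summands such as - d + d.
ℚ-ring : ACR.AlmostCommutativeRing 0ℓ 0ℓ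
ℚ-ring = ACR.fromCommutativeRing ℚP.+-*-commutativeRing (λ x → dec⇒maybe (0ℚ ℚP.≟ x))

toℚᵘ-ℕ→ℚ : ∀ m → toℚᵘ (ℕ→ℚ m) ≡ ℚᵘ.mkℚᵘ (+ m) 0
toℚᵘ-ℕ→ℚ m = cong toℚᵘ (ℚP.normalize-coprime (Coprimality.sym (Coprimality.1-coprimeTo m)))

ℕ→ℚ-+ : ∀ a b → ℕ→ℚ (a ℕ.+ b) ≡ ℕ→ℚ a + ℕ→ℚ b
ℕ→ℚ-+ a b = ℚP.toℚᵘ-injective (begin
  toℚᵘ (ℕ→ℚ (a ℕ.+ b))                                ≡⟨ toℚᵘ-ℕ→ℚ (a ℕ.+ b) ⟩
  ℚᵘ.mkℚᵘ (+ a ℤ.+ + b) 0                             ≈⟨ ℚᵘ.*≡* (shape (+ a) (+ b)) ⟩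
  ℚᵘ.mkℚᵘ (+ a) 0 ℚᵘ.+ ℚᵘ.mkℚᵘ (+ b) 0               ≡⟨ sym (cong₂ ℚᵘ._+_ (toℚᵘ-ℕ→ℚ a) (toℚᵘ-ℕ→ℚ b)) ⟩
  toℚᵘ (ℕ→ℚ a) ℚᵘ.+ toℚᵘ (ℕ→ℚ b)                    ≈⟨ ℚP.toℚᵘ-homo-+ (ℕ→ℚ a) (ℕ→ℚ b) ⟨
  toℚᵘ (ℕ→ℚ a + ℕ→ℚ b)                                ∎)
  where
  open ℚᵘP.≃-Reasoning
  shape : ∀ x y → (x ℤ.+ y) ℤ.* + 1 ≡ (x ℤ.* + 1 ℤ.+ y ℤ.* + 1) ℤ.* + 1
  shape = ℤSolver.solve-∀

ℕ→ℚ-* : ∀ a b → ℕ→ℚ (a ℕ.* b) ≡ ℕ→ℚ a * ℕ→ℚ b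
ℕ→ℚ-* a b = ℚP.toℚᵘ-injective (begin
  toℚᵘ (ℕ→ℚ (a ℕ.* b))                                ≡⟨ toℚᵘ-ℕ→ℚ (a ℕ.* b) ⟩
  ℚᵘ.mkℚᵘ (+ (a ℕ.* b)) 0                             ≡⟨ cong (λ x → ℚᵘ.mkℚᵘ x 0) (ℤP.pos-* a b) ⟩
  ℚᵘ.mkℚᵘ (+ a) 0 ℚᵘ.* ℚᵘ.mkℚᵘ (+ b) 0               ≡⟨ sym (cong₂ ℚᵘ._*_ (toℚᵘ-ℕ→ℚ a) (toℚᵘ-ℕ→ℚ b)) ⟩
  toℚᵘ (ℕ→ℚ a) ℚᵘ.* toℚᵘ (ℕ→ℚ b)                    ≈⟨ ℚP.toℚᵘ-homo-* (ℕ→ℚ a) (ℕ→ℚ b) ⟨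
  toℚᵘ (ℕ→ℚ a * ℕ→ℚ b)                                ∎)
  where open ℚᵘP.≃-Reasoning

sumBelow-cong : ∀ n {f g : ℕ → ℚ} → (∀ k → k ℕ.< n → f k ≡ g k) → sumBelow n f ≡ sumBelow n g
sumBelow-cong zero    f≗g = refl
sumBelow-cong (suc n) f≗g =
  cong₂ _+_ (sumBelow-cong n (λ k k<n → f≗g k (ℕP.m<n⇒m<1+n k<n))) (f≗g n ℕP.≤-refl)

sumBelow-+ : ∀ n (f g : ℕ → ℚ) → sumBelow n (λ k → f k + g k) ≡ sumBelow n f + sumBelow n g
sumBelow-+ zero    f g = refl
sumBelow-+ (suc n) f g = trans (cong (_+ (f n + g n)) (sumBelow-+ n f g)) (interchange (sumBelow n f) (sumBelow n g) (f n) (g n))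
  where
  interchange : ∀ a b c d → (a + b) + (c + d) ≡ (a + c) + (b + d)
  interchange = solve-∀ ℚ-ring

sumBelow-*ˡ : ∀ n c (f : ℕ → ℚ) → sumBelow n (λ k → c * f k) ≡ c * sumBelow n f
sumBelow-*ˡ zero    c f = sym (ℚP.*-zeroʳ c)
sumBelow-*ˡ (suc n) c f =
  trans (cong (_+ c * f n) (sumBelow-*ˡ n c f)) (sym (ℚP.*-distribˡ-+ c (sumBelow n f) (f n)))

sumBelow-neg : ∀ n (f : ℕ → ℚ) → sumBelow n (λ k → - f k) ≡ - sumBelow n f
sumBelow-neg zero    f = refl
sumBelow-neg (suc n) f =
  trans (cong (_+ - f n) (sumBelow-neg n f)) (sym (ℚP.neg-distrib-+ (sumBelow n f) (f n)))

sumBelow-suc : ∀ n (f : ℕ → ℚ) → sumBelow (suc n) f ≡ f 0 + sumBelow n (λ k → f (suc k))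
sumBelow-suc zero    f = ℚP.+-comm 0ℚ (f 0)
sumBelow-suc (suc n) f = trans (cong (_+ f (suc n)) (sumBelow-suc n f)) (ℚP.+-assoc (f 0) _ _)

two : ℚ
two = ℕ→ℚ 2

2^-suc : ∀ e → 2^ (e ℤ.+ + 1) ≡ two * 2^ e
2^-suc (+ m)             = trans (cong (λ i → ℕ→ℚ (2 ℕ.^ i)) (ℕP.+-comm m 1)) (ℕ→ℚ-* 2 (2 ℕ.^ m))
2^-suc -[1+ zero ]       = refl
2^-suc -[1+ suc m ]      = twice-half (2^ -[1+ m ])
  where
  twice-half : ∀ x → x ≡ two * (x * ½)
  twice-half = solve-∀ ℚ-ring

weight : ℕ → ℚ
weight k = sgn k * 2^ (ℤ.- (+ k))

twice-weight-suc : ∀ k → two * weight (suc k) ≡ - weight k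
twice-weight-suc k = begin
  two * (- sgn k * 2^ (ℤ.- (+ suc k)))     ≡⟨ rearrange (sgn k) (2^ (ℤ.- (+ suc k))) two ⟩
  - (sgn k * (two * 2^ (ℤ.- (+ suc k))))   ≡⟨ cong (λ x → - (sgn k * x)) (sym (2^-suc (ℤ.- (+ suc k)))) ⟩
  - (sgn k * 2^ (ℤ.- (+ suc k) ℤ.+ + 1))   ≡⟨ cong (λ e → - (sgn k * 2^ e)) (exponent (+ k)) ⟩
  - weight k                                 ∎
  where
  open ≡-Reasoning
  rearrange : ∀ s p t → t * (- s * p) ≡ - (s * (t * p))
  rearrange = solve-∀ ℚ-ring
  exponent : ∀ x → ℤ.- (+ 1 ℤ.+ x) ℤ.+ + 1 ≡ ℤ.- x
  exponent = ℤSolver.solve-∀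

sumBelow-twice-weight-suc : ∀ n (f : ℕ → ℚ) →
  two * sumBelow n (λ k → weight (suc k) * f k) ≡ - sumBelow n (λ k → weight k * f k)
sumBelow-twice-weight-suc n f = begin
  two * sumBelow n (λ k → weight (suc k) * f k)   ≡⟨ sumBelow-*ˡ n two _ ⟨
  sumBelow n (λ k → two * (weight (suc k) * f k)) ≡⟨ sumBelow-cong n (λ k _ → twice-summand k) ⟩
  sumBelow n (λ k → - (weight k * f k))           ≡⟨ sumBelow-neg n _ ⟩
  - sumBelow n (λ k → weight k * f k)             ∎
  where
  open ≡-Reasoning
  twice-summand : ∀ k → two * (weight (suc k) * f k) ≡ - (weight k * f k)
  twice-summand k = begin
    two * (weight (suc k) * f k)   ≡⟨ ℚP.*-assoc two (weight (suc k)) (f k) ⟨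
    two * weight (suc k) * f k     ≡⟨ cong (_* f k) (twice-weight-suc k) ⟩
    - weight k * f k               ≡⟨ ℚP.neg-distribˡ-* (weight k) (f k) ⟨
    - (weight k * f k)             ∎

binom : ℕ → ℕ → ℚ
binom m k = ℕ→ℚ ((m ℕ.+ k) C k)

binom-pascal : ∀ m j → binom (suc m) (suc j) ≡ binom (suc m) j + binom m (suc j)
binom-pascal m j = begin
  ℕ→ℚ (suc (m ℕ.+ suc j) C suc j)                         ≡⟨ cong ℕ→ℚ (nCk+nC[k+1]≡[n+1]C[k+1] (m ℕ.+ suc j) j) ⟨
  ℕ→ℚ ((m ℕ.+ suc j) C j ℕ.+ (m ℕ.+ suc j) C suc j)       ≡⟨ ℕ→ℚ-+ ((m ℕ.+ suc j) C j) ((m ℕ.+ suc j) C suc j) ⟩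
  ℕ→ℚ ((m ℕ.+ suc j) C j) + binom m (suc j)               ≡⟨ cong (λ i → ℕ→ℚ (i C j) + binom m (suc j)) (ℕP.+-suc m j) ⟩
  binom (suc m) j + binom m (suc j)                        ∎
  where open ≡-Reasoning

central : ℕ → ℚ
central n = ℕ→ℚ ((2 ℕ.* n ℕ.+ 1) C n)

binom-below-diagonal : ∀ n → binom n (suc n) ≡ central n
binom-below-diagonal n = cong ℕ→ℚ (begin
  (n ℕ.+ suc n) C suc n                         ≡⟨ nCk≡nC[n∸k] (ℕP.m≤n+m (suc n) n) ⟩
  (n ℕ.+ suc n) C (n ℕ.+ suc n ℕ.∸ suc n)      ≡⟨ cong ((n ℕ.+ suc n) C_) (ℕP.m+n∸n≡m n (suc n)) ⟩
  (n ℕ.+ suc n) C n                             ≡⟨ cong (_C n) (n+suc-n n) ⟩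
  (2 ℕ.* n ℕ.+ 1) C n                           ∎)
  where
  open ≡-Reasoning
  n+suc-n : ∀ n → n ℕ.+ suc n ≡ 2 ℕ.* n ℕ.+ 1
  n+suc-n = ℕSolver.solve-∀

binom-diagonal : ∀ n → binom (suc n) (suc n) ≡ two * central n
binom-diagonal n = begin
  binom (suc n) (suc n)             ≡⟨ binom-pascal n n ⟩
  binom (suc n) n + binom n (suc n) ≡⟨ cong₂ _+_ (cong (λ i → ℕ→ℚ (i C n)) (suc-n+n n)) (binom-below-diagonal n) ⟩
  central n + central n             ≡⟨ double (central n) ⟩
  two * central n                   ∎
  where
  open ≡-Reasoning
  suc-n+n : ∀ n → suc n ℕ.+ n ≡ 2 ℕ.* n ℕ.+ 1
  suc-n+n = ℕSolver.solve-∀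
  double : ∀ x → x + x ≡ two * x
  double = solve-∀ ℚ-ring

module FibonacciType (X : ℕ → ℚ) (X-rec : ∀ j → X (suc (suc j)) ≡ X (suc j) + X j) where

  X-rec₃ : ∀ j → X (3 ℕ.+ j) ≡ two * X (suc j) + X j
  X-rec₃ j = begin
    X (3 ℕ.+ j)                          ≡⟨ X-rec (suc j) ⟩
    X (2 ℕ.+ j) + X (suc j)              ≡⟨ cong (_+ X (suc j)) (X-rec j) ⟩
    (X (suc j) + X j) + X (suc j)        ≡⟨ collect (X (suc j)) (X j) ⟩
    two * X (suc j) + X j                ∎
    where
    open ≡-Reasoning
    collect : ∀ a b → (a + b) + a ≡ two * a + b
    collect = solve-∀ ℚ-ring

  X-∸-rec₃ : ∀ q {k} → k ≤ q → X (3 ℕ.+ q ℕ.∸ k) ≡ two * X (suc q ℕ.∸ k) + X (q ℕ.∸ k)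
  X-∸-rec₃ q {k} k≤q = begin
    X (3 ℕ.+ q ℕ.∸ k)                     ≡⟨ cong X (ℕP.+-∸-assoc 3 k≤q) ⟩
    X (3 ℕ.+ (q ℕ.∸ k))                   ≡⟨ X-rec₃ (q ℕ.∸ k) ⟩
    two * X (suc (q ℕ.∸ k)) + X (q ℕ.∸ k) ≡⟨ cong (λ i → two * X i + X (q ℕ.∸ k)) (ℕP.+-∸-assoc 1 k≤q) ⟨
    two * X (suc q ℕ.∸ k) + X (q ℕ.∸ k)   ∎
    where open ≡-Reasoning

  term : ℕ → ℕ → ℕ → ℚ
  term m p k = weight k * (binom m k * X (p ℕ.∸ k))

  sumBelow-term-rec₃ : ∀ m q N → N ≤ suc q →
    sumBelow N (term m (3 ℕ.+ q)) ≡ two * sumBelow N (term m (suc q)) + sumBelow N (term m q)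
  sumBelow-term-rec₃ m q N N≤1+q = begin
    sumBelow N (term m (3 ℕ.+ q))
      ≡⟨ sumBelow-cong N (λ k k<N → cong (λ x → weight k * (binom m k * x)) (X-∸-rec₃ q (ℕP.≤-pred (ℕP.≤-trans k<N N≤1+q)))) ⟩
    sumBelow N (λ k → weight k * (binom m k * (two * X (suc q ℕ.∸ k) + X (q ℕ.∸ k))))
      ≡⟨ sumBelow-cong N (λ k _ → distribute (weight k) (binom m k) (X (suc q ℕ.∸ k)) (X (q ℕ.∸ k))) ⟩
    sumBelow N (λ k → two * term m (suc q) k + term m q k)
      ≡⟨ sumBelow-+ N _ _ ⟩
    sumBelow N (λ k → two * term m (suc q) k) + sumBelow N (term m q)
      ≡⟨ cong (_+ sumBelow N (term m q)) (sumBelow-*ˡ N two (term m (suc q))) ⟩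
    two * sumBelow N (term m (suc q)) + sumBelow N (term m q)
      ∎
    where
    open ≡-Reasoning
    distribute : ∀ w b x y → w * (b * (two * x + y)) ≡ two * (w * (b * x)) + w * (b * y)
    distribute = solve-∀ ℚ-ring

  sumBelow-term-pascal : ∀ m p N →
    sumBelow (suc N) (term (suc m) (suc p))
      ≡ sumBelow (suc N) (term m (suc p)) + sumBelow N (λ j → weight (suc j) * (binom (suc m) j * X (p ℕ.∸ j)))
  sumBelow-term-pascal m p N = begin
    sumBelow (suc N) (term (suc m) (suc p))
      ≡⟨ sumBelow-suc N (term (suc m) (suc p)) ⟩
    term m (suc p) 0 + sumBelow N (λ j → term (suc m) (suc p) (suc j))
      ≡⟨ cong (λ s → term m (suc p) 0 + s) (sumBelow-cong N (λ j _ → split j)) ⟩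
    term m (suc p) 0 + sumBelow N (λ j → term m (suc p) (suc j) + U j)
      ≡⟨ cong (λ s → term m (suc p) 0 + s) (sumBelow-+ N _ U) ⟩
    term m (suc p) 0 + (sumBelow N (λ j → term m (suc p) (suc j)) + sumBelow N U)
      ≡⟨ ℚP.+-assoc (term m (suc p) 0) _ (sumBelow N U) ⟨
    (term m (suc p) 0 + sumBelow N (λ j → term m (suc p) (suc j))) + sumBelow N U
      ≡⟨ cong (_+ sumBelow N U) (sumBelow-suc N (term m (suc p))) ⟨
    sumBelow (suc N) (term m (suc p)) + sumBelow N U
      ∎
    where
    open ≡-Reasoning
    U : ℕ → ℚ
    U j = weight (suc j) * (binom (suc m) j * X (p ℕ.∸ j))
    distribute : ∀ w a b x → w * ((a + b) * x) ≡ w * (b * x) + w * (a * x)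
    distribute = solve-∀ ℚ-ring
    split : ∀ j → term (suc m) (suc p) (suc j) ≡ term m (suc p) (suc j) + U j
    split j = trans (cong (λ b → weight (suc j) * (b * X (p ℕ.∸ j))) (binom-pascal m j))
                    (distribute (weight (suc j)) (binom (suc m) j) (binom m (suc j)) (X (p ℕ.∸ j)))

  leftSum : ℕ → ℚ
  leftSum n = sumBelow (suc n) (term n (2 ℕ.* (n ℕ.+ 1)))

  boundary-terms : ∀ n →
    two * term n (suc (n ℕ.+ suc n)) (suc n) + term (suc n) (n ℕ.+ suc n) (suc n)
      ≡ - (weight n * central n * X (n ℕ.+ 2))
  boundary-terms n = begin
    two * (weight (suc n) * (binom n (suc n) * X (n ℕ.+ suc n ℕ.∸ n)))
      + weight (suc n) * (binom (suc n) (suc n) * X (n ℕ.+ suc n ℕ.∸ suc n))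
      ≡⟨ cong₂ _+_ (cong₂ (λ b i → two * (weight (suc n) * (b * X i))) (binom-below-diagonal n) (ℕP.m+n∸m≡n n (suc n)))
                   (cong₂ (λ b i → weight (suc n) * (b * X i)) (binom-diagonal n) (ℕP.m+n∸n≡m n (suc n))) ⟩
    two * (weight (suc n) * (central n * X (suc n))) + weight (suc n) * (two * central n * X n)
      ≡⟨ factor two (weight (suc n)) (central n) (X (suc n)) (X n) ⟩
    two * weight (suc n) * central n * (X (suc n) + X n)
      ≡⟨ cong₂ (λ w x → w * central n * x) (twice-weight-suc n) (trans (sym (X-rec n)) (cong X (ℕP.+-comm 2 n))) ⟩
    - weight n * central n * X (n ℕ.+ 2)
      ≡⟨ pull-neg (weight n) (central n) (X (n ℕ.+ 2)) ⟩
    - (weight n * central n * X (n ℕ.+ 2))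
      ∎
    where
    open ≡-Reasoning
    factor : ∀ t w k a b → t * (w * (k * a)) + w * (t * k * b) ≡ t * w * k * (a + b)
    factor = solve-∀ ℚ-ring
    pull-neg : ∀ w k x → - w * k * x ≡ - (w * k * x)
    pull-neg = solve-∀ ℚ-ring

  leftSum-suc : ∀ n → leftSum (suc n) ≡ two * leftSum n - weight n * central n * X (n ℕ.+ 2)
  leftSum-suc n = begin
    leftSum (suc n)
      ≡⟨ cong (λ p → sumBelow (2 ℕ.+ n) (term (suc n) p)) (twice-suc-suc n) ⟩
    sumBelow (2 ℕ.+ n) (term (suc n) (3 ℕ.+ q))
      ≡⟨ sumBelow-term-rec₃ (suc n) q (2 ℕ.+ n) (ℕ.s≤s (ℕP.m≤n+m (suc n) n)) ⟩
    two * sumBelow (2 ℕ.+ n) (term (suc n) (suc q)) + sumBelow (2 ℕ.+ n) (term (suc n) q)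
      ≡⟨ cong (λ a → two * a + sumBelow (2 ℕ.+ n) (term (suc n) q)) (sumBelow-term-pascal n q (suc n)) ⟩
    two * ((sumBelow (suc n) (term n (suc q)) + T₁) + Σ′) + (Σ + T₂)
      ≡⟨ cong (λ s → two * ((s + T₁) + Σ′) + (Σ + T₂)) (cong (λ p → sumBelow (suc n) (term n p)) (twice-suc n)) ⟨
    two * ((leftSum n + T₁) + Σ′) + (Σ + T₂)
      ≡⟨ cancel (leftSum n) T₁ Σ′ Σ T₂ (sumBelow-twice-weight-suc (suc n) (λ j → binom (suc n) j * X (q ℕ.∸ j))) ⟩
    two * leftSum n + (two * T₁ + T₂)
      ≡⟨ cong (λ z → two * leftSum n + z) (boundary-terms n) ⟩
    two * leftSum n - weight n * central n * X (n ℕ.+ 2)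
      ∎
    where
    open ≡-Reasoning
    q : ℕ
    q = n ℕ.+ suc n
    T₁ T₂ Σ Σ′ : ℚ
    T₁ = term n (suc q) (suc n)
    T₂ = term (suc n) q (suc n)
    Σ  = sumBelow (suc n) (term (suc n) q)
    Σ′ = sumBelow (suc n) (λ j → weight (suc j) * (binom (suc n) j * X (q ℕ.∸ j)))
    twice-suc-suc : ∀ m → 2 ℕ.* (suc m ℕ.+ 1) ≡ 3 ℕ.+ (m ℕ.+ suc m)
    twice-suc-suc = ℕSolver.solve-∀
    twice-suc : ∀ m → 2 ℕ.* (m ℕ.+ 1) ≡ suc (m ℕ.+ suc m)
    twice-suc = ℕSolver.solve-∀
    cancel : ∀ s a u d b → two * u ≡ - d → two * ((s + a) + u) + (d + b) ≡ two * s + (two * a + b)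
    cancel s a u d b 2u≡-d = begin
      two * ((s + a) + u) + (d + b)           ≡⟨ regroup s a u d b ⟩
      two * s + (two * a + b) + (two * u + d) ≡⟨ cong (λ v → two * s + (two * a + b) + (v + d)) 2u≡-d ⟩
      two * s + (two * a + b) + (- d + d)     ≡⟨ drop (two * s + (two * a + b)) d ⟩
      two * s + (two * a + b)                 ∎
      where
      regroup : ∀ s a u d b → two * ((s + a) + u) + (d + b) ≡ two * s + (two * a + b) + (two * u + d)
      regroup = solve-∀ ℚ-ring
      drop : ∀ x d → x + (- d + d) ≡ x
      drop = solve-∀ ℚ-ring

  rightTerm : ℕ → ℕ → ℚ
  rightTerm n k = sgn k * central k * 2^ (+ n ℤ.- + (2 ℕ.* k) ℤ.- + 1) * X (k ℕ.+ 2)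

  rightSide : ℕ → ℚ
  rightSide n = X 2 * 2^ (+ n) - sumBelow n (rightTerm n)

  rightTerm-suc : ∀ n k → rightTerm (suc n) k ≡ two * rightTerm n k
  rightTerm-suc n k = begin
    s * 2^ (+ suc n ℤ.- + (2 ℕ.* k) ℤ.- + 1) * x       ≡⟨ cong (λ e → s * 2^ e * x) (exponent (+ n) (+ (2 ℕ.* k))) ⟩
    s * 2^ (e ℤ.+ + 1) * x                                ≡⟨ cong (λ y → s * y * x) (2^-suc e) ⟩
    s * (two * 2^ e) * x                                  ≡⟨ rearrange s (2^ e) x ⟩
    two * (s * 2^ e * x)                                  ∎
    where
    open ≡-Reasoning
    s = sgn k * central k
    x = X (k ℕ.+ 2)
    e = + n ℤ.- + (2 ℕ.* k) ℤ.- + 1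
    exponent : ∀ a b → (+ 1 ℤ.+ a) ℤ.- b ℤ.- + 1 ≡ (a ℤ.- b ℤ.- + 1) ℤ.+ + 1
    exponent = ℤSolver.solve-∀
    rearrange : ∀ s p x → s * (two * p) * x ≡ two * (s * p * x)
    rearrange = solve-∀ ℚ-ring

  rightTerm-last : ∀ n → rightTerm (suc n) n ≡ weight n * central n * X (n ℕ.+ 2)
  rightTerm-last n = begin
    sgn n * central n * 2^ (+ suc n ℤ.- + (2 ℕ.* n) ℤ.- + 1) * X (n ℕ.+ 2) ≡⟨ cong (λ e → sgn n * central n * 2^ e * X (n ℕ.+ 2)) (exponent (+ n)) ⟩
    sgn n * central n * 2^ (ℤ.- (+ n)) * X (n ℕ.+ 2)                        ≡⟨ rearrange (sgn n) (central n) (2^ (ℤ.- (+ n))) (X (n ℕ.+ 2)) ⟩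
    weight n * central n * X (n ℕ.+ 2)                                       ∎
    where
    open ≡-Reasoning
    -- + (2 ℕ.* n) unfolds to + n ℤ.+ (+ n ℤ.+ + 0)
    exponent : ∀ a → (+ 1 ℤ.+ a) ℤ.- (a ℤ.+ (a ℤ.+ + 0)) ℤ.- + 1 ≡ ℤ.- a
    exponent = ℤSolver.solve-∀
    rearrange : ∀ s c p x → s * c * p * x ≡ s * p * c * x
    rearrange = solve-∀ ℚ-ring

  rightSide-suc : ∀ n → rightSide (suc n) ≡ two * rightSide n - weight n * central n * X (n ℕ.+ 2)
  rightSide-suc n = begin
    X 2 * 2^ (+ suc n) - (sumBelow n (rightTerm (suc n)) + rightTerm (suc n) n)
      ≡⟨ cong₂ (λ p σ → X 2 * p - σ) (ℕ→ℚ-* 2 (2 ℕ.^ n)) (cong₂ _+_ doubled (rightTerm-last n)) ⟩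
    X 2 * (two * 2^ (+ n)) - (two * sumBelow n (rightTerm n) + Z)
      ≡⟨ rearrange (X 2) (2^ (+ n)) (sumBelow n (rightTerm n)) Z ⟩
    two * rightSide n - Z
      ∎
    where
    open ≡-Reasoning
    Z = weight n * central n * X (n ℕ.+ 2)
    doubled : sumBelow n (rightTerm (suc n)) ≡ two * sumBelow n (rightTerm n)
    doubled = trans (sumBelow-cong n (λ k _ → rightTerm-suc n k)) (sumBelow-*ˡ n two (rightTerm n))
    rearrange : ∀ c p σ z → c * (two * p) - (two * σ + z) ≡ two * (c * p - σ) - z
    rearrange = solve-∀ ℚ-ring

  leftSum≡rightSide : ∀ n → leftSum n ≡ rightSide n
  leftSum≡rightSide zero    = base (X 2)
    where
    -- weight 0, binom 0 0 and 2^ (+ 0) compute to 1ℚ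
    base : ∀ x → 0ℚ + 1ℚ * (1ℚ * x) ≡ x * 1ℚ - 0ℚ
    base = solve-∀ ℚ-ring
  leftSum≡rightSide (suc n) = begin
    leftSum (suc n)                           ≡⟨ leftSum-suc n ⟩
    two * leftSum n - Z                       ≡⟨ cong (λ s → two * s - Z) (leftSum≡rightSide n) ⟩
    two * rightSide n - Z                     ≡⟨ rightSide-suc n ⟨
    rightSide (suc n)                         ∎
    where
    open ≡-Reasoning
    Z = weight n * central n * X (n ℕ.+ 2)

  binomial-sum-identity : ∀ n →
    sumBelow (suc n) (λ k → sgn k * binom n k * X (2 ℕ.* (n ℕ.+ 1) ℕ.∸ k) * 2^ (ℤ.- (+ k)))
      ≡ X 2 * 2^ (+ n) - sumBelow n (rightTerm n)
  binomial-sum-identity n =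
    trans (sumBelow-cong (suc n) (λ k _ → rearrange (sgn k) (binom n k) (X (2 ℕ.* (n ℕ.+ 1) ℕ.∸ k)) (2^ (ℤ.- (+ k)))))
          (leftSum≡rightSide n)
    where
    rearrange : ∀ s b x p → s * b * x * p ≡ s * p * (b * x)
    rearrange = solve-∀ ℚ-ring

theorem16 : (n : ℕ) →
    (sumBelow (suc n) (λ k → sgn k * ℕ→ℚ ((n ℕ.+ k) C k) * ℕ→ℚ (F (2 ℕ.* (n ℕ.+ 1) ℕ.∸ k)) * 2^ (ℤ.- (+ k)))
      ≡ 2^ (+ n) - sumBelow n (λ k → sgn k * ℕ→ℚ ((2 ℕ.* k ℕ.+ 1) C k) * 2^ (+ n ℤ.- + (2 ℕ.* k) ℤ.- + 1) * ℕ→ℚ (F (k ℕ.+ 2))))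
    × (sumBelow (suc n) (λ k → sgn k * ℕ→ℚ ((n ℕ.+ k) C k) * ℕ→ℚ (L (2 ℕ.* (n ℕ.+ 1) ℕ.∸ k)) * 2^ (ℤ.- (+ k)))
      ≡ ℕ→ℚ 3 * 2^ (+ n) - sumBelow n (λ k → sgn k * ℕ→ℚ ((2 ℕ.* k ℕ.+ 1) C k) * 2^ (+ n ℤ.- + (2 ℕ.* k) ℤ.- + 1) * ℕ→ℚ (L (k ℕ.+ 2))))
theorem16 n =
    trans (Fibonacci.binomial-sum-identity n) (cong (_- sumBelow n (Fibonacci.rightTerm n)) (ℚP.*-identityˡ (2^ (+ n))))
  , Lucas.binomial-sum-identity n
  where
  module Fibonacci = FibonacciType (λ j → ℕ→ℚ (F j)) (λ j → ℕ→ℚ-+ (F (suc j)) (F j))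
  module Lucas     = FibonacciType (λ j → ℕ→ℚ (L j)) (λ j → ℕ→ℚ-+ (L (suc j)) (L j))
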